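{- HyperQPTL is strictly more expressive than FO$[<,E]$: for every FO$[<,E]$ sentence over $AP$ there is an equivalent HyperQPTL formula (equivalent meaning satisfied by exactly the same sets of traces $T\subseteq(2^{AP})^\omega$), but there is a HyperQPTL formula for which no equivalent FO$[<,E]$ sentence exists.
   Context: A trace over $AP$ is an infinite sequence $t\in(2^{AP})^\omega$; $t[i]$ is its $i$-th element. HyperQPTL syntax: $\varphi ::= \forall\pi.\varphi \mid \exists\pi.\varphi \mid \exists q.\varphi \mid \forall q.\varphi \mid \psi$, $\psi ::= a_\pi \mid q \mid \neg\psi \mid \psi\vee\psi \mid \mathsf{X}\psi \mid \psi\,\mathsf{U}\,\psi$, where $a\in AP$, $\pi$ ranges over trace variables and $q$ over propositional variables (quantifiers in prenex form). Semantics over a set of traces $T$, an assignment $\Pi$ (mapping trace variables to traces of $T$ and each propositional variable $q$ to a trace in $(2^{\{q\}})^\omega$) and a position $i$: $\Pi,i\models_T a_\pi$ iff $a\in\Pi(\pi)[i]$; $\Pi,i\models_T q$ iff $q\in\Pi(q)[i]$; Boolean connectives as usual; $\mathsf X\varphi$ holds at $i$ iff $\varphi$ holds at $i+1$; $\varphi_1\mathsf U\varphi_2$ holds at $i$ iff there is $j\ge i$ where $\varphi_2$ holds and $\varphi_1$ holds at all $k$ with $i\le k<j$; $\exists\pi.\varphi$ holds iff $\varphi$ holds under $\Pi[\pi\mapsto t]$ for some $t\in T$; $\exists q.\varphi$ holds iff $\varphi$ holds under $\Pi[q\mapsto t]$ for some $t\in(2^{\{q\}})^\omega$; universal quantifiers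 dual. $T\models\varphi$ iff $\emptyset,0\models_T\varphi$. FO$[<,E]$: first-order formulas built from $P_a(x)$, $x<y$, $x=y$, $E(x,y)$ with $\neg,\vee,\exists x$, interpreted over a set of traces $T$ with variables ranging over $T\times\mathbb N$: $P_a((t,n))$ iff $a\in t[n]$; $(t_1,n_1)<(t_2,n_2)$ iff $t_1=t_2$ and $n_1<n_2$; $E((t_1,n_1),(t_2,n_2))$ iff $n_1=n_2$. -}

module Defs where

open import Data.Nat using (ℕ; zero; suc; _≤_; _<_; _+_)
open import Data.Fin using (Fin)
open import Data.Bool using (Bool; true)
open import Data.Product using (Σ; _×_; _,_; proj₁; proj₂)
open import Data.Sum using (_⊎_)
open import Data.Empty using (⊥)
open import Relation.Nullary using (¬_)
open import Relation.Binary.PropositionalEquality using (_≡_)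

-- Atomic propositions: AP = Fin n (a finite set of n propositions).
-- A trace t ∈ (2^AP)^ω is a function ℕ → AP → Bool; a ∈ t[i] iff t i a ≡ true.

Trace : ℕ → Set
Trace n = ℕ → Fin n → Bool

TraceSet : ℕ → Set₁
TraceSet n = Trace n → Set

_≈ₜ_ : {n : ℕ} → Trace n → Trace n → Set
t₁ ≈ₜ t₂ = ∀ i a → t₁ i a ≡ t₂ i a

-- A trace over the single proposition q, (2^{q})^ω: q ∈ t[i] iff t i ≡ true.
PTrace : Set
PTrace = ℕ → Bool

-- Cons onto an environment (de Bruijn: index zero = innermost binder).
extend : {A : Set} {m : ℕ} → A → (Fin m → A) → Fin (suc m) → A
extend x ρ Fin.zero    = x
extend x ρ (Fin.suc j) = ρ j

-- HyperQPTL, well-scoped (de Bruijn), in prenex form.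
-- m = number of trace variables in scope, p = number of propositional
-- variables in scope.

data Body (n m p : ℕ) : Set where
  atom  : Fin n → Fin m → Body n m p
  pvar  : Fin p → Body n m p
  ¬'_   : Body n m p → Body n m p
  _∨'_  : Body n m p → Body n m p → Body n m p
  X'_   : Body n m p → Body n m p
  _U'_  : Body n m p → Body n m p → Body n m p

data HQ (n m p : ℕ) : Set where
  ∀π    : HQ n (suc m) p → HQ n m p
  ∃π    : HQ n (suc m) p → HQ n m p
  ∃q    : HQ n m (suc p) → HQ n m p
  ∀q    : HQ n m (suc p) → HQ n m p
  body  : Body n m p → HQ n m p

HyperQPTL : ℕ → Set
HyperQPTL n = HQ n 0 0

⟦_⟧B : {n m p : ℕ} → Body n m p → (Fin m → Trace n) → (Fin p → PTrace) → ℕ → Set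
⟦ atom a π ⟧B Πt Πq i = Πt π i a ≡ true
⟦ pvar q   ⟧B Πt Πq i = Πq q i ≡ true
⟦ ¬' ψ     ⟧B Πt Πq i = ¬ ⟦ ψ ⟧B Πt Πq i
⟦ ψ₁ ∨' ψ₂ ⟧B Πt Πq i = ⟦ ψ₁ ⟧B Πt Πq i ⊎ ⟦ ψ₂ ⟧B Πt Πq i
⟦ X' ψ     ⟧B Πt Πq i = ⟦ ψ ⟧B Πt Πq (suc i)
⟦ ψ₁ U' ψ₂ ⟧B Πt Πq i =
  Σ ℕ λ j → i ≤ j × ⟦ ψ₂ ⟧B Πt Πq j × (∀ k → i ≤ k → k < j → ⟦ ψ₁ ⟧B Πt Πq k)

⟦_⟧H : {n m p : ℕ} → HQ n m p → TraceSet n → (Fin m → Trace n) → (Fin p → PTrace) → ℕ → Set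
⟦ ∀π φ   ⟧H T Πt Πq i = (t : Trace _) → T t → ⟦ φ ⟧H T (extend t Πt) Πq i
⟦ ∃π φ   ⟧H T Πt Πq i = Σ (Trace _) λ t → T t × ⟦ φ ⟧H T (extend t Πt) Πq i
⟦ ∃q φ   ⟧H T Πt Πq i = Σ PTrace λ s → ⟦ φ ⟧H T Πt (extend s Πq) i
⟦ ∀q φ   ⟧H T Πt Πq i = (s : PTrace) → ⟦ φ ⟧H T Πt (extend s Πq) i
⟦ body ψ ⟧H T Πt Πq i = ⟦ ψ ⟧B Πt Πq i

emptyEnv : {A : Set} → Fin 0 → A
emptyEnv ()

_⊨H_ : {n : ℕ} → TraceSet n → HyperQPTL n → Set
T ⊨H φ = ⟦ φ ⟧H T emptyEnv emptyEnv 0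

-- FO[<,E], well-scoped; variables range over T × ℕ.

data FO (n m : ℕ) : Set where
  P    : Fin n → Fin m → FO n m
  _<'_ : Fin m → Fin m → FO n m
  _='_ : Fin m → Fin m → FO n m
  E    : Fin m → Fin m → FO n m
  ¬ᶠ_  : FO n m → FO n m
  _∨ᶠ_ : FO n m → FO n m → FO n m
  ∃ᶠ   : FO n (suc m) → FO n m

FOSentence : ℕ → Set
FOSentence n = FO n 0

Pos : ℕ → Set
Pos n = Trace n × ℕ

⟦_⟧F : {n m : ℕ} → FO n m → TraceSet n → (Fin m → Pos n) → Set
⟦ P a x    ⟧F T ρ = proj₁ (ρ x) (proj₂ (ρ x)) a ≡ true
⟦ x <' y   ⟧F T ρ = (proj₁ (ρ x) ≈ₜ proj₁ (ρ y)) × (proj₂ (ρ x) < proj₂ (ρ y))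
⟦ x =' y   ⟧F T ρ = (proj₁ (ρ x) ≈ₜ proj₁ (ρ y)) × (proj₂ (ρ x) ≡ proj₂ (ρ y))
⟦ E x y    ⟧F T ρ = proj₂ (ρ x) ≡ proj₂ (ρ y)
⟦ ¬ᶠ φ     ⟧F T ρ = ¬ ⟦ φ ⟧F T ρ
⟦ φ₁ ∨ᶠ φ₂ ⟧F T ρ = ⟦ φ₁ ⟧F T ρ ⊎ ⟦ φ₂ ⟧F T ρ
⟦ ∃ᶠ φ     ⟧F T ρ = Σ (Trace _) λ t → T t × Σ ℕ λ k → ⟦ φ ⟧F T (extend (t , k) ρ)

_⊨F_ : {n : ℕ} → TraceSet n → FOSentence n → Set
T ⊨F φ = ⟦ φ ⟧F T emptyEnv

Equivalent : {n : ℕ} → FOSentence n → HyperQPTL n → Set₁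
Equivalent {n} ψ φ = (T : TraceSet n) → ((T ⊨F ψ) → (T ⊨H φ)) × ((T ⊨H φ) → (T ⊨F ψ))

module Submission where

open import Defs
open import Level using (0ℓ)
open import Axiom.ExcludedMiddle using (ExcludedMiddle)
open import Axiom.DoubleNegationElimination using (DoubleNegationElimination; em⇒dne)
open import Data.Nat using (ℕ; zero; suc; _+_; _∸_; _^_; _⊔_; _⊓_; _≡ᵇ_; _≤_; _<_; z≤n; s≤s; _≤?_)
open import Data.Nat.Properties
open import Data.Bool using (Bool; true; false; not)
open import Data.Bool.Properties using (T-≡; ¬-not; not-¬; not-involutive) renaming (_≟_ to _≟ᵇ_)
open import Data.Fin using (Fin; lift)
open import Data.Product using (Σ; _×_; _,_; proj₁; proj₂; uncurry)
open import Data.Product.Function.NonDependent.Propositional using (_×-⇔_)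
open import Data.Sum using (_⊎_; inj₁; inj₂; [_,_]′; swap)
open import Data.Sum.Function.Propositional using (_⊎-⇔_)
open import Data.Empty using (⊥; ⊥-elim)
open import Function using (_∘_; id)
open import Function.Bundles using (_⇔_; mk⇔; Equivalence)
open import Function.Related.TypeIsomorphisms using (¬-cong-⇔; →-cong-⇔)
import Function.Properties.Equivalence as ⇔
open import Relation.Nullary using (¬_; yes; no; Dec; Stable)
open import Relation.Nullary.Decidable using (decidable-stable; toSum)
open import Relation.Binary.Definitions using (tri<; tri≈; tri>)
open import Relation.Binary.PropositionalEquality

-- Expressiveness: a position variable of FO[<,E], ranging over pairs (t, i), becomes a trace
-- quantifier π together with a propositional quantifier q forced to hold exactly at i; the atoms
-- become LTL conditions on π and q, and with excluded middle ¬ and ∨ can be pushed through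
-- quantifier prefixes, keeping the formula in prenex form.
--
-- Strictness: ∀π ∃q. q ∧ ((q ↮ X q) U (q ∧ a_π)) says of a singleton {t} in which every
-- proposition holds exactly at position K that K is even. On such singletons an FO sentence of
-- quantifier depth r only sees the linear order ℕ with the point K, and an Ehrenfeucht–Fraïssé
-- argument shows that it cannot tell K = 2 · 2^r from K + 1: positions are matched by the identity
-- left of a gap and by the successor right of it, and after j rounds the gap is still 2^(r - j) away
-- from 0, from K and from every chosen point, which leaves room to answer the next move.

open Equivalence using (to; from)

Σ-cong-⇔ : ∀ {A : Set} {B C : A → Set} → (∀ x → B x ⇔ C x) → Σ A B ⇔ Σ A C
Σ-cong-⇔ B⇔C = mk⇔ (λ (x , b) → x , to (B⇔C x) b) (λ (x , c) → x , from (B⇔C x) c)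

Π-cong-⇔ : ∀ {A : Set} {B C : A → Set} → (∀ x → B x ⇔ C x) → ((x : A) → B x) ⇔ ((x : A) → C x)
Π-cong-⇔ B⇔C = mk⇔ (λ f x → to (B⇔C x) (f x)) (λ g x → from (B⇔C x) (g x))

_∧'_ : ∀ {n m p} → Body n m p → Body n m p → Body n m p
A ∧' B = ¬' ((¬' A) ∨' (¬' B))

_↔'_ : ∀ {n m p} → Body n m p → Body n m p → Body n m p
A ↔' B = (A ∧' B) ∨' ((¬' A) ∧' (¬' B))

-- Body has no constants; any c ∨ ¬ c serves as truth.
⊤' : ∀ {n m p} → Body n m p → Body n m p
⊤' c = c ∨' (¬' c)

F' : ∀ {n m p} → Body n m p → Body n m p
F' ψ = ⊤' ψ U' ψ

G' : ∀ {n m p} → Body n m p → Body n m p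
G' ψ = ¬' (F' (¬' ψ))

⋀ : ∀ {n m p l} → Body n m p → (Fin l → Body n m p) → Body n m p
⋀ {l = zero}  ⊤ f = ⊤
⋀ {l = suc l} ⊤ f = f Fin.zero ∧' ⋀ ⊤ (f ∘ Fin.suc)

renameBody : ∀ {n m m' p p'} → (Fin m → Fin m') → (Fin p → Fin p') → Body n m p → Body n m' p'
renameBody f g (atom a π) = atom a (f π)
renameBody f g (pvar q)   = pvar (g q)
renameBody f g (¬' b)     = ¬' renameBody f g b
renameBody f g (b ∨' c)   = renameBody f g b ∨' renameBody f g c
renameBody f g (X' b)     = X' renameBody f g b
renameBody f g (b U' c)   = renameBody f g b U' renameBody f g c

rename : ∀ {n m m' p p'} → (Fin m → Fin m') → (Fin p → Fin p') → HQ n m p → HQ n m' p'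
rename f g (∀π φ)   = ∀π (rename (lift 1 f) g φ)
rename f g (∃π φ)   = ∃π (rename (lift 1 f) g φ)
rename f g (∃q φ)   = ∃q (rename f (lift 1 g) φ)
rename f g (∀q φ)   = ∀q (rename f (lift 1 g) φ)
rename f g (body b) = body (renameBody f g b)

weakenπBody : ∀ {n m p} → Body n m p → Body n (suc m) p
weakenπBody = renameBody Fin.suc id

weakenqBody : ∀ {n m p} → Body n m p → Body n m (suc p)
weakenqBody = renameBody id Fin.suc

weakenπ : ∀ {n m p} → HQ n m p → HQ n (suc m) p
weakenπ = rename Fin.suc id

weakenq : ∀ {n m p} → HQ n m p → HQ n m (suc p)
weakenq = rename id Fin.suc

neg : ∀ {n m p} → HQ n m p → HQ n m p
neg (∀π φ)   = ∃π (neg φ)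
neg (∃π φ)   = ∀π (neg φ)
neg (∃q φ)   = ∀q (neg φ)
neg (∀q φ)   = ∃q (neg φ)
neg (body b) = body (¬' b)

orBody : ∀ {n m p} → HQ n m p → Body n m p → HQ n m p
orBody (∀π φ)   b = ∀π (orBody φ (weakenπBody b))
orBody (∃π φ)   b = ∃π (orBody φ (weakenπBody b))
orBody (∃q φ)   b = ∃q (orBody φ (weakenqBody b))
orBody (∀q φ)   b = ∀q (orBody φ (weakenqBody b))
orBody (body c) b = body (c ∨' b)

or : ∀ {n m p} → HQ n m p → HQ n m p → HQ n m p
or (∀π φ)   ψ = ∀π (or φ (weakenπ ψ))
or (∃π φ)   ψ = ∃π (or φ (weakenπ ψ))
or (∃q φ)   ψ = ∃q (or φ (weakenq ψ))
or (∀q φ)   ψ = ∀q (or φ (weakenq ψ))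
or (body b) ψ = orBody ψ b

and : ∀ {n m p} → HQ n m p → HQ n m p → HQ n m p
and φ ψ = neg (or (neg φ) (neg ψ))

sameTrace : ∀ {n m} → Fin m → Fin m → Body n m m
sameTrace x y = G' (⋀ (⊤' (pvar x)) λ a → atom a x ↔' atom a y)

once : ∀ {n m} → Body n (suc m) (suc m)
once = (¬' q) U' (q ∧' (X' (G' (¬' q))))
  where q = pvar Fin.zero

-- FO variable x (de Bruijn index x) becomes trace variable π_x and propositional variable q_x,
-- with q_x marking the position of x on π_x.
translate : ∀ {n m} → FO n m → HQ n m m
translate (P a x)  = body (F' (pvar x ∧' atom a x))
translate (x <' y) = body (sameTrace x y ∧' F' (pvar x ∧' (X' (F' (pvar y)))))
translate (x =' y) = body (sameTrace x y ∧' F' (pvar x ∧' pvar y))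
translate (E x y)  = body (F' (pvar x ∧' pvar y))
translate (¬ᶠ φ)   = neg (translate φ)
translate (φ ∨ᶠ ψ) = or (translate φ) (translate ψ)
translate (∃ᶠ φ)   = ∃π (∃q (and (body once) (translate φ)))

↔'-bool : ∀ b c → (¬ (¬ b ≡ true ⊎ ¬ c ≡ true) ⊎ ¬ (¬ ¬ b ≡ true ⊎ ¬ ¬ c ≡ true)) ⇔ (b ≡ c)
↔'-bool true true = mk⇔ (λ _ → refl) (λ _ → inj₁ λ { (inj₁ h) → h refl ; (inj₂ h) → h refl })
↔'-bool false false = mk⇔ (λ _ → refl) (λ _ → inj₂ λ { (inj₁ h) → h (λ ()) ; (inj₂ h) → h (λ ()) })
↔'-bool true false =
  mk⇔ (λ { (inj₁ h) → ⊥-elim (h (inj₂ λ ())) ; (inj₂ h) → ⊥-elim (h (inj₁ λ k → k refl)) }) (λ ())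
↔'-bool false true =
  mk⇔ (λ { (inj₁ h) → ⊥-elim (h (inj₁ λ ())) ; (inj₂ h) → ⊥-elim (h (inj₂ λ k → k refl)) }) (λ ())

∧'-intro : ∀ {A B : Set} → A → B → ¬ (¬ A ⊎ ¬ B)
∧'-intro a b = [ (λ ¬a → ¬a a) , (λ ¬b → ¬b b) ]′

∧'-elim : ∀ {A B : Set} → Stable A → Stable B → ¬ (¬ A ⊎ ¬ B) → A × B
∧'-elim stable-A stable-B ¬¬A×B = stable-A (¬¬A×B ∘ inj₁) , stable-B (¬¬A×B ∘ inj₂)

point : ℕ → PTrace
point k j = j ≡ᵇ k

Marks : PTrace → ℕ → Set
Marks s k = ∀ j → (s j ≡ true) ⇔ (j ≡ k)

point-marks : ∀ k → Marks (point k) k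
point-marks k j = ⇔.trans (⇔.sym T-≡) (mk⇔ (≡ᵇ⇒≡ j k) (≡⇒≡ᵇ j k))

extend-lift : ∀ {A : Set} {m m'} {f : Fin m → Fin m'} {Π : Fin m → A} {Π' : Fin m' → A} x →
  (∀ i → Π' (f i) ≡ Π i) → ∀ i → extend x Π' (lift 1 f i) ≡ extend x Π i
extend-lift x Π'∘f≡Π Fin.zero    = refl
extend-lift x Π'∘f≡Π (Fin.suc i) = Π'∘f≡Π i

renameBody-⇔ : ∀ {n m m' p p'} (b : Body n m p) {f : Fin m → Fin m'} {g : Fin p → Fin p'} {Πt Πt' Πq Πq'} →
  (∀ i → Πt' (f i) ≡ Πt i) → (∀ i → Πq' (g i) ≡ Πq i) →
  ∀ k → ⟦ renameBody f g b ⟧B Πt' Πq' k ⇔ ⟦ b ⟧B Πt Πq k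
renameBody-⇔ (atom a π) hf hg k rewrite hf π = ⇔.refl
renameBody-⇔ (pvar q)   hf hg k rewrite hg q = ⇔.refl
renameBody-⇔ (¬' b)     hf hg k = ¬-cong-⇔ (renameBody-⇔ b hf hg k)
renameBody-⇔ (b ∨' c)   hf hg k = renameBody-⇔ b hf hg k ⊎-⇔ renameBody-⇔ c hf hg k
renameBody-⇔ (X' b)     hf hg k = renameBody-⇔ b hf hg (suc k)
renameBody-⇔ (b U' c)   hf hg k = Σ-cong-⇔ λ j → ⇔.refl ×-⇔ renameBody-⇔ c hf hg j ×-⇔
  Π-cong-⇔ λ l → →-cong-⇔ ⇔.refl (→-cong-⇔ ⇔.refl (renameBody-⇔ b hf hg l))

rename-⇔ : ∀ {n m m' p p'} {T : TraceSet n} (φ : HQ n m p) {f : Fin m → Fin m'} {g : Fin p → Fin p'}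
  {Πt Πt' Πq Πq'} →
  (∀ i → Πt' (f i) ≡ Πt i) → (∀ i → Πq' (g i) ≡ Πq i) →
  ∀ k → ⟦ rename f g φ ⟧H T Πt' Πq' k ⇔ ⟦ φ ⟧H T Πt Πq k
rename-⇔ (∀π φ)   hf hg k = Π-cong-⇔ λ t → →-cong-⇔ ⇔.refl (rename-⇔ φ (extend-lift t hf) hg k)
rename-⇔ (∃π φ)   hf hg k = Σ-cong-⇔ λ t → ⇔.refl ×-⇔ rename-⇔ φ (extend-lift t hf) hg k
rename-⇔ (∃q φ)   hf hg k = Σ-cong-⇔ λ s → rename-⇔ φ hf (extend-lift s hg) k
rename-⇔ (∀q φ)   hf hg k = Π-cong-⇔ λ s → rename-⇔ φ hf (extend-lift s hg) k
rename-⇔ (body b) hf hg k = renameBody-⇔ b hf hg k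

weakenπ-⇔ : ∀ {n m p} {T : TraceSet n} (φ : HQ n m p) t {Πt Πq} k →
  ⟦ weakenπ φ ⟧H T (extend t Πt) Πq k ⇔ ⟦ φ ⟧H T Πt Πq k
weakenπ-⇔ φ t k = rename-⇔ φ (λ _ → refl) (λ _ → refl) k

weakenq-⇔ : ∀ {n m p} {T : TraceSet n} (φ : HQ n m p) s {Πt Πq} k →
  ⟦ weakenq φ ⟧H T Πt (extend s Πq) k ⇔ ⟦ φ ⟧H T Πt Πq k
weakenq-⇔ φ s k = rename-⇔ φ (λ _ → refl) (λ _ → refl) k

weakenπBody-⇔ : ∀ {n m p} (b : Body n m p) t {Πt Πq} k →
  ⟦ weakenπBody b ⟧B (extend t Πt) Πq k ⇔ ⟦ b ⟧B Πt Πq k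
weakenπBody-⇔ b t k = renameBody-⇔ b (λ _ → refl) (λ _ → refl) k

weakenqBody-⇔ : ∀ {n m p} (b : Body n m p) s {Πt Πq} k →
  ⟦ weakenqBody b ⟧B Πt (extend s Πq) k ⇔ ⟦ b ⟧B Πt Πq k
weakenqBody-⇔ b s k = renameBody-⇔ b (λ _ → refl) (λ _ → refl) k

¬Σ⇔Π¬ : ∀ {X : Set} {A : X → Set} → (¬ Σ X A) ⇔ ((x : X) → ¬ A x)
¬Σ⇔Π¬ = mk⇔ (λ ¬∃ x a → ¬∃ (x , a)) (λ ∀¬ (x , a) → ∀¬ x a)

¬Σ⇔Π¬-guarded : ∀ {X : Set} {Q A : X → Set} → (¬ Σ X (λ x → Q x × A x)) ⇔ ((x : X) → Q x → ¬ A x)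
¬Σ⇔Π¬-guarded = mk⇔ (λ ¬∃ x q a → ¬∃ (x , q , a)) (λ ∀¬ (x , q , a) → ∀¬ x q a)

Σ-⊎ʳ : ∀ {X : Set} {A : X → Set} {B : Set} → X → Σ X (λ x → A x ⊎ B) ⇔ (Σ X A ⊎ B)
Σ-⊎ʳ x₀ = mk⇔ (λ { (x , inj₁ a) → inj₁ (x , a) ; (x , inj₂ b) → inj₂ b })
              (λ { (inj₁ (x , a)) → x , inj₁ a ; (inj₂ b) → x₀ , inj₂ b })

Σ-⊎ʳ-guarded : ∀ {X : Set} {Q A : X → Set} {B : Set} → Σ X Q →
  Σ X (λ x → Q x × (A x ⊎ B)) ⇔ (Σ X (λ x → Q x × A x) ⊎ B)
Σ-⊎ʳ-guarded (x₀ , q₀) = mk⇔ (λ { (x , q , inj₁ a) → inj₁ (x , q , a) ; (x , q , inj₂ b) → inj₂ b })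
                             (λ { (inj₁ (x , q , a)) → x , q , inj₁ a ; (inj₂ b) → x₀ , q₀ , inj₂ b })

Represents : ∀ {n m} → (Fin m → Trace n) → (Fin m → PTrace) → (Fin m → Pos n) → Set
Represents Πt Πq ρ = ∀ i → Πt i ≡ proj₁ (ρ i) × Marks (Πq i) (proj₂ (ρ i))

∅ : ∀ {n} → TraceSet n
∅ _ = ⊥

FO-empty : ∀ {n m} (φ : FO n m) {T : TraceSet n} → (∀ t → ¬ T t) →
  ∀ ρ → ⟦ φ ⟧F T ρ ⇔ ⟦ φ ⟧F ∅ ρ
FO-empty (P a x)  _ ρ = ⇔.refl
FO-empty (x <' y) _ ρ = ⇔.refl
FO-empty (x =' y) _ ρ = ⇔.refl
FO-empty (E x y)  _ ρ = ⇔.refl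
FO-empty (¬ᶠ φ)   T-empty ρ = ¬-cong-⇔ (FO-empty φ T-empty ρ)
FO-empty (φ ∨ᶠ ψ) T-empty ρ = FO-empty φ T-empty ρ ⊎-⇔ FO-empty ψ T-empty ρ
FO-empty (∃ᶠ φ)   T-empty ρ = mk⇔ (λ (t , t∈T , _) → ⊥-elim (T-empty t t∈T)) (λ ())

module _ {n m p} {T : TraceSet n} {t₀} (t₀∈T : T t₀) (φ : HQ n m p) where

  vacuous-∀π : ∀ {Πt Πq k} → ⟦ ∀π (weakenπ φ) ⟧H T Πt Πq k ⇔ ⟦ φ ⟧H T Πt Πq k
  vacuous-∀π {k = k} = mk⇔ (λ ∀φ → to (weakenπ-⇔ φ t₀ k) (∀φ t₀ t₀∈T))
                           (λ φ-holds t _ → from (weakenπ-⇔ φ t k) φ-holds)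

  vacuous-∃π : ∀ {Πt Πq k} → ⟦ ∃π (weakenπ φ) ⟧H T Πt Πq k ⇔ ⟦ φ ⟧H T Πt Πq k
  vacuous-∃π {k = k} = mk⇔ (λ (t , _ , φ-holds) → to (weakenπ-⇔ φ t k) φ-holds)
                           (λ φ-holds → t₀ , t₀∈T , from (weakenπ-⇔ φ t₀ k) φ-holds)

equivalent : ∀ {n} {ψ : FOSentence n} φ → (∀ T → (T ⊨F ψ) ⇔ (T ⊨H φ)) → Equivalent ψ φ
equivalent φ ψ⇔φ T = to (ψ⇔φ T) , from (ψ⇔φ T)

module Classical (em : ExcludedMiddle 0ℓ) where

  dne : DoubleNegationElimination 0ℓ
  dne = em⇒dne em

  ¬Π⇔Σ¬ : ∀ {X : Set} {A : X → Set} → (¬ ((x : X) → A x)) ⇔ Σ X (¬_ ∘ A)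
  ¬Π⇔Σ¬ = mk⇔ (λ ¬∀ → dne λ ¬∃ → ¬∀ λ x → dne λ ¬a → ¬∃ (x , ¬a))
              (λ (x , ¬a) ∀a → ¬a (∀a x))

  ¬Π⇔Σ¬-guarded : ∀ {X : Set} {Q A : X → Set} → (¬ ((x : X) → Q x → A x)) ⇔ Σ X (λ x → Q x × ¬ A x)
  ¬Π⇔Σ¬-guarded = mk⇔ (λ ¬∀ → dne λ ¬∃ → ¬∀ λ x q → dne λ ¬a → ¬∃ (x , q , ¬a))
                      (λ (x , q , ¬a) ∀a → ¬a (∀a x q))

  neg-⇔ : ∀ {n m p} {T : TraceSet n} (φ : HQ n m p) Πt Πq k →
    ⟦ neg φ ⟧H T Πt Πq k ⇔ (¬ ⟦ φ ⟧H T Πt Πq k)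
  neg-⇔ (∀π φ) Πt Πq k =
    ⇔.trans (Σ-cong-⇔ λ t → ⇔.refl ×-⇔ neg-⇔ φ _ Πq k) (⇔.sym ¬Π⇔Σ¬-guarded)
  neg-⇔ (∃π φ) Πt Πq k =
    ⇔.trans (Π-cong-⇔ λ t → →-cong-⇔ ⇔.refl (neg-⇔ φ _ Πq k)) (⇔.sym ¬Σ⇔Π¬-guarded)
  neg-⇔ (∃q φ) Πt Πq k = ⇔.trans (Π-cong-⇔ λ s → neg-⇔ φ Πt _ k) (⇔.sym ¬Σ⇔Π¬)
  neg-⇔ (∀q φ) Πt Πq k = ⇔.trans (Σ-cong-⇔ λ s → neg-⇔ φ Πt _ k) (⇔.sym ¬Π⇔Σ¬)
  neg-⇔ (body b) Πt Πq k = ⇔.refl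

  Π-⊎ʳ : ∀ {X : Set} {A : X → Set} {B : Set} → ((x : X) → A x ⊎ B) ⇔ (((x : X) → A x) ⊎ B)
  Π-⊎ʳ = mk⇔ (λ ∀a⊎b → [ inj₂ , (λ ¬b → inj₁ λ x → [ id , ⊥-elim ∘ ¬b ]′ (∀a⊎b x)) ]′
                          (toSum em))
             [ (λ ∀a x → inj₁ (∀a x)) , (λ b x → inj₂ b) ]′

  Π-⊎ʳ-guarded : ∀ {X : Set} {Q A : X → Set} {B : Set} →
    ((x : X) → Q x → A x ⊎ B) ⇔ (((x : X) → Q x → A x) ⊎ B)
  Π-⊎ʳ-guarded = mk⇔ (λ ∀a⊎b → [ inj₂ , (λ ¬b → inj₁ λ x q → [ id , ⊥-elim ∘ ¬b ]′ (∀a⊎b x q)) ]′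
                                  (toSum em))
                     [ (λ ∀a x q → inj₁ (∀a x q)) , (λ b x q → inj₂ b) ]′

  ¬[¬⊎¬]⇔× : ∀ {A B : Set} → (¬ (¬ A ⊎ ¬ B)) ⇔ (A × B)
  ¬[¬⊎¬]⇔× = mk⇔ (∧'-elim dne dne) (uncurry ∧'-intro)

  -- Pulling an ∃π out of a disjunction needs a trace to instantiate it with.
  module _ {n} {T : TraceSet n} {t₀} (t₀∈T : T t₀) where

    orBody-⇔ : ∀ {m p} (φ : HQ n m p) b Πt Πq k →
      ⟦ orBody φ b ⟧H T Πt Πq k ⇔ (⟦ φ ⟧H T Πt Πq k ⊎ ⟦ b ⟧B Πt Πq k)
    orBody-⇔ (∀π φ) b Πt Πq k = ⇔.trans (Π-cong-⇔ λ t → →-cong-⇔ ⇔.refl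
      (⇔.trans (orBody-⇔ φ _ _ Πq k) (⇔.refl ⊎-⇔ weakenπBody-⇔ b t k))) Π-⊎ʳ-guarded
    orBody-⇔ (∃π φ) b Πt Πq k = ⇔.trans (Σ-cong-⇔ λ t → ⇔.refl ×-⇔
      ⇔.trans (orBody-⇔ φ _ _ Πq k) (⇔.refl ⊎-⇔ weakenπBody-⇔ b t k)) (Σ-⊎ʳ-guarded (t₀ , t₀∈T))
    orBody-⇔ (∃q φ) b Πt Πq k = ⇔.trans (Σ-cong-⇔ λ s →
      ⇔.trans (orBody-⇔ φ _ Πt _ k) (⇔.refl ⊎-⇔ weakenqBody-⇔ b s k)) (Σ-⊎ʳ (λ _ → true))
    orBody-⇔ (∀q φ) b Πt Πq k = ⇔.trans (Π-cong-⇔ λ s →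
      ⇔.trans (orBody-⇔ φ _ Πt _ k) (⇔.refl ⊎-⇔ weakenqBody-⇔ b s k)) Π-⊎ʳ
    orBody-⇔ (body c) b Πt Πq k = ⇔.refl

    or-⇔ : ∀ {m p} (φ ψ : HQ n m p) Πt Πq k →
      ⟦ or φ ψ ⟧H T Πt Πq k ⇔ (⟦ φ ⟧H T Πt Πq k ⊎ ⟦ ψ ⟧H T Πt Πq k)
    or-⇔ (∀π φ) ψ Πt Πq k = ⇔.trans (Π-cong-⇔ λ t → →-cong-⇔ ⇔.refl
      (⇔.trans (or-⇔ φ _ _ Πq k) (⇔.refl ⊎-⇔ weakenπ-⇔ ψ t k))) Π-⊎ʳ-guarded
    or-⇔ (∃π φ) ψ Πt Πq k = ⇔.trans (Σ-cong-⇔ λ t → ⇔.refl ×-⇔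
      ⇔.trans (or-⇔ φ _ _ Πq k) (⇔.refl ⊎-⇔ weakenπ-⇔ ψ t k)) (Σ-⊎ʳ-guarded (t₀ , t₀∈T))
    or-⇔ (∃q φ) ψ Πt Πq k = ⇔.trans (Σ-cong-⇔ λ s →
      ⇔.trans (or-⇔ φ _ Πt _ k) (⇔.refl ⊎-⇔ weakenq-⇔ ψ s k)) (Σ-⊎ʳ (λ _ → true))
    or-⇔ (∀q φ) ψ Πt Πq k = ⇔.trans (Π-cong-⇔ λ s →
      ⇔.trans (or-⇔ φ _ Πt _ k) (⇔.refl ⊎-⇔ weakenq-⇔ ψ s k)) Π-⊎ʳ
    or-⇔ (body b) ψ Πt Πq k = ⇔.trans (orBody-⇔ ψ b Πt Πq k) (mk⇔ swap swap)

    and-⇔ : ∀ {m p} (φ ψ : HQ n m p) Πt Πq k →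
      ⟦ and φ ψ ⟧H T Πt Πq k ⇔ (⟦ φ ⟧H T Πt Πq k × ⟦ ψ ⟧H T Πt Πq k)
    and-⇔ φ ψ Πt Πq k = ⇔.trans (neg-⇔ (or (neg φ) (neg ψ)) Πt Πq k)
      (⇔.trans (¬-cong-⇔ (⇔.trans (or-⇔ (neg φ) (neg ψ) Πt Πq k)
                                    (neg-⇔ φ Πt Πq k ⊎-⇔ neg-⇔ ψ Πt Πq k)))
               ¬[¬⊎¬]⇔×)

  module _ {n m p} (Πt : Fin m → Trace n) (Πq : Fin p → PTrace) where

    ⊤'-holds : ∀ c k → ⟦ ⊤' c ⟧B Πt Πq k
    ⊤'-holds c k = toSum em

    F-⇔ : ∀ ψ k → ⟦ F' ψ ⟧B Πt Πq k ⇔ Σ ℕ (λ j → k ≤ j × ⟦ ψ ⟧B Πt Πq j)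
    F-⇔ ψ k = mk⇔ (λ (j , k≤j , ψj , _) → j , k≤j , ψj)
                  (λ (j , k≤j , ψj) → j , k≤j , ψj , λ l _ _ → ⊤'-holds ψ l)

    G-⇔ : ∀ ψ k → ⟦ G' ψ ⟧B Πt Πq k ⇔ (∀ j → k ≤ j → ⟦ ψ ⟧B Πt Πq j)
    G-⇔ ψ k = ⇔.trans (¬-cong-⇔ (F-⇔ (¬' ψ) k))
      (mk⇔ (λ ¬F j k≤j → dne λ ¬ψj → ¬F (j , k≤j , ¬ψj)) (λ G (j , k≤j , ¬ψj) → ¬ψj (G j k≤j)))

    ⋀-⇔ : ∀ {l} ⊤ (f : Fin l → Body n m p) k → ⟦ ⊤ ⟧B Πt Πq k →
      ⟦ ⋀ ⊤ f ⟧B Πt Πq k ⇔ (∀ i → ⟦ f i ⟧B Πt Πq k)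
    ⋀-⇔ {zero}  ⊤ f k ⊤-holds = mk⇔ (λ _ ()) (λ _ → ⊤-holds)
    ⋀-⇔ {suc l} ⊤ f k ⊤-holds = ⇔.trans ¬[¬⊎¬]⇔× (⇔.trans (⇔.refl ×-⇔ ⋀-⇔ ⊤ (f ∘ Fin.suc) k ⊤-holds)
      (mk⇔ (λ { (f₀ , fₛ) Fin.zero → f₀ ; (f₀ , fₛ) (Fin.suc i) → fₛ i })
           (λ ∀f → ∀f Fin.zero , ∀f ∘ Fin.suc)))

    F-at-mark : ∀ {x k} χ → Marks (Πq x) k → ⟦ F' (pvar x ∧' χ) ⟧B Πt Πq 0 ⇔ ⟦ χ ⟧B Πt Πq k
    F-at-mark {x} {k} χ marks = ⇔.trans (F-⇔ (pvar x ∧' χ) 0) (mk⇔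
      (λ (j , _ , x∧χ) → let (xj , χj) = to ¬[¬⊎¬]⇔× x∧χ
                         in subst (⟦ χ ⟧B Πt Πq) (to (marks j) xj) χj)
      (λ χk → k , z≤n , from ¬[¬⊎¬]⇔× (from (marks k) refl , χk)))

    F-mark : ∀ {y k} i → Marks (Πq y) k → ⟦ F' (pvar y) ⟧B Πt Πq i ⇔ (i ≤ k)
    F-mark {y} {k} i marks = ⇔.trans (F-⇔ (pvar y) i)
      (mk⇔ (λ (j , i≤j , yj) → subst (i ≤_) (to (marks j) yj) i≤j)
           (λ i≤k → k , i≤k , from (marks k) refl))

  sameTrace-⇔ : ∀ {n m} (x y : Fin m) (Πt : Fin m → Trace n) Πq →
    ⟦ sameTrace x y ⟧B Πt Πq 0 ⇔ (Πt x ≈ₜ Πt y)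
  sameTrace-⇔ {n} {m} x y Πt Πq = ⇔.trans (G-⇔ Πt Πq same 0)
    (mk⇔ (λ G j → to (same-⇔ j) (G j z≤n)) (λ x≈y j _ → from (same-⇔ j) (x≈y j)))
    where
    same : Body n m m
    same = ⋀ (⊤' (pvar x)) λ a → atom a x ↔' atom a y
    same-⇔ : ∀ j → ⟦ same ⟧B Πt Πq j ⇔ (∀ a → Πt x j a ≡ Πt y j a)
    same-⇔ j = ⇔.trans (⋀-⇔ Πt Πq (⊤' (pvar x)) _ j (⊤'-holds Πt Πq (pvar x) j))
                        (Π-cong-⇔ λ a → ↔'-bool _ _)

  once-⇔ : ∀ {n m} (Πt : Fin (suc m) → Trace n) s (Πq : Fin m → PTrace) →
    ⟦ once ⟧B Πt (extend s Πq) 0 ⇔ Σ ℕ (Marks s)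
  once-⇔ Πt s Πq = mk⇔
    (λ (k , _ , sk∧after , before) → let (sk , after) = to ¬[¬⊎¬]⇔× sk∧after in
      k , λ j → mk⇔ (only-k k before (to (never-after k) after) j) λ { refl → sk })
    (λ (k , marks) → k , z≤n ,
      from ¬[¬⊎¬]⇔× (from (marks k) refl ,
                     from (never-after k) λ j k<j sj → <-irrefl (sym (to (marks j) sj)) k<j) ,
      λ j _ j<k sj → <-irrefl (to (marks j) sj) j<k)
    where
    never-after : ∀ k →
      ⟦ G' (¬' pvar Fin.zero) ⟧B Πt (extend s Πq) (suc k) ⇔ (∀ j → suc k ≤ j → s j ≢ true)
    never-after k = G-⇔ Πt (extend s Πq) (¬' pvar Fin.zero) (suc k)
    only-k : ∀ k → (∀ j → 0 ≤ j → j < k → s j ≢ true) → (∀ j → suc k ≤ j → s j ≢ true) →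
      ∀ j → s j ≡ true → j ≡ k
    only-k k before after j sj with <-cmp j k
    ... | tri< j<k _ _ = ⊥-elim (before j z≤n j<k sj)
    ... | tri≈ _ j≡k _ = j≡k
    ... | tri> _ _ k<j = ⊥-elim (after j k<j sj)

  module _ {n m} {Πt : Fin m → Trace n} {Πq ρ} (rep : Represents Πt Πq ρ) (x y : Fin m) where

    trace-eq : ⟦ sameTrace x y ⟧B Πt Πq 0 ⇔ (proj₁ (ρ x) ≈ₜ proj₁ (ρ y))
    trace-eq = subst₂ (λ t u → _ ⇔ (t ≈ₜ u)) (proj₁ (rep x)) (proj₁ (rep y)) (sameTrace-⇔ x y Πt Πq)

    position-eq : ⟦ F' (pvar x ∧' pvar y) ⟧B Πt Πq 0 ⇔ (proj₂ (ρ x) ≡ proj₂ (ρ y))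
    position-eq = ⇔.trans (F-at-mark Πt Πq (pvar y) (proj₂ (rep x))) (proj₂ (rep y) (proj₂ (ρ x)))

  module _ {n} {T : TraceSet n} {t₀} (t₀∈T : T t₀) where

    translate-⇔ : ∀ {m} (φ : FO n m) {Πt Πq ρ} → Represents Πt Πq ρ →
      ⟦ translate φ ⟧H T Πt Πq 0 ⇔ ⟦ φ ⟧F T ρ
    translate-⇔ (P a x) {Πt} {Πq} {ρ} rep =
      subst (λ t → _ ⇔ (t (proj₂ (ρ x)) a ≡ true)) (proj₁ (rep x))
            (F-at-mark Πt Πq (atom a x) (proj₂ (rep x)))
    translate-⇔ (x <' y) {Πt} {Πq} rep = ⇔.trans ¬[¬⊎¬]⇔×
      (trace-eq rep x y ×-⇔ ⇔.trans (F-at-mark Πt Πq (X' (F' (pvar y))) (proj₂ (rep x)))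
                                     (F-mark Πt Πq _ (proj₂ (rep y))))
    translate-⇔ (x =' y) rep = ⇔.trans ¬[¬⊎¬]⇔× (trace-eq rep x y ×-⇔ position-eq rep x y)
    translate-⇔ (E x y) rep = position-eq rep x y
    translate-⇔ (¬ᶠ φ) rep = ⇔.trans (neg-⇔ (translate φ) _ _ 0) (¬-cong-⇔ (translate-⇔ φ rep))
    translate-⇔ (φ ∨ᶠ ψ) rep = ⇔.trans (or-⇔ t₀∈T (translate φ) (translate ψ) _ _ 0)
      (translate-⇔ φ rep ⊎-⇔ translate-⇔ ψ rep)
    translate-⇔ (∃ᶠ φ) {Πt} {Πq} {ρ} rep = Σ-cong-⇔ λ t → ⇔.refl ×-⇔ mk⇔
      (λ (s , once∧φ) → let (once-holds , φ-holds) = to (once-and-⇔ t s) once∧φ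
                            (k , marks) = to (once-⇔ (extend t Πt) s Πq) once-holds
                        in k , to (translate-⇔ φ (represents-extend t marks)) φ-holds)
      (λ (k , φ-holds) → point k , from (once-and-⇔ t (point k))
        (from (once-⇔ (extend t Πt) (point k) Πq) (k , point-marks k) ,
         from (translate-⇔ φ (represents-extend t (point-marks k))) φ-holds))
      where
      represents-extend : ∀ t {s k} → Marks s k → Represents (extend t Πt) (extend s Πq) (extend (t , k) ρ)
      represents-extend t marks Fin.zero    = refl , marks
      represents-extend t marks (Fin.suc i) = rep i
      once-and-⇔ : ∀ t s → ⟦ and (body once) (translate φ) ⟧H T (extend t Πt) (extend s Πq) 0 ⇔
        (⟦ once ⟧B (extend t Πt) (extend s Πq) 0 × ⟦ translate φ ⟧H T (extend t Πt) (extend s Πq) 0)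
      once-and-⇔ t s = and-⇔ t₀∈T (body once) (translate φ) (extend t Πt) (extend s Πq) 0

  -- On T = ∅ every ∀π holds and every ∃π fails, whereas the translation needs a trace to pull
  -- quantifiers out of disjunctions; a vacuous outermost quantifier chosen by the truth of ψ on ∅
  -- settles the empty case.
  FO⇒HyperQPTL : ∀ {n} (ψ : FOSentence n) → Σ (HyperQPTL n) (Equivalent ψ)
  FO⇒HyperQPTL {n} ψ with em {∅ ⊨F ψ}
  ... | yes ∅⊨ψ = φ , equivalent φ λ T → by-cases T (em {Σ (Trace n) T})
    where
    φ : HyperQPTL n
    φ = ∀π (weakenπ (translate ψ))
    by-cases : ∀ T → Dec (Σ (Trace n) T) → (T ⊨F ψ) ⇔ (T ⊨H φ)
    by-cases T (yes (t₀ , t₀∈T)) =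
      ⇔.sym (⇔.trans (vacuous-∀π t₀∈T (translate ψ)) (translate-⇔ t₀∈T ψ λ ()))
    by-cases T (no ∄t) = mk⇔ (λ _ t t∈T → ⊥-elim (∄t (t , t∈T)))
      (λ _ → from (FO-empty ψ (λ t t∈T → ∄t (t , t∈T)) emptyEnv) ∅⊨ψ)
  ... | no ∅⊭ψ = φ , equivalent φ λ T → by-cases T (em {Σ (Trace n) T})
    where
    φ : HyperQPTL n
    φ = ∃π (weakenπ (translate ψ))
    by-cases : ∀ T → Dec (Σ (Trace n) T) → (T ⊨F ψ) ⇔ (T ⊨H φ)
    by-cases T (yes (t₀ , t₀∈T)) =
      ⇔.sym (⇔.trans (vacuous-∃π t₀∈T (translate ψ)) (translate-⇔ t₀∈T ψ λ ()))
    by-cases T (no ∄t) =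
      mk⇔ (λ T⊨ψ → ⊥-elim (∅⊭ψ (to (FO-empty ψ (λ t t∈T → ∄t (t , t∈T)) emptyEnv) T⊨ψ)))
      (λ (t , t∈T , _) → ⊥-elim (∄t (t , t∈T)))

-- FO[<,E] over the positions of a single trace that holds every proposition exactly at K.
⟦_⟧ℕ : ∀ {n m} → FO n m → ℕ → (Fin m → ℕ) → Set
⟦ P a x    ⟧ℕ K p = p x ≡ K
⟦ x <' y   ⟧ℕ K p = p x < p y
⟦ x =' y   ⟧ℕ K p = p x ≡ p y
⟦ E x y    ⟧ℕ K p = p x ≡ p y
⟦ ¬ᶠ φ     ⟧ℕ K p = ¬ ⟦ φ ⟧ℕ K p
⟦ φ ∨ᶠ ψ   ⟧ℕ K p = ⟦ φ ⟧ℕ K p ⊎ ⟦ ψ ⟧ℕ K p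
⟦ ∃ᶠ φ     ⟧ℕ K p = Σ ℕ λ z → ⟦ φ ⟧ℕ K (extend z p)

pointTrace : ∀ {n} → ℕ → Trace n
pointTrace k j _ = point k j

Singleton : ∀ {n} → Trace n → TraceSet n
Singleton t u = u ≡ t

singleton-⇔ : ∀ {n m} K (φ : FO n m) {ρ : Fin m → Pos n} {p : Fin m → ℕ} →
  (∀ i → ρ i ≡ (pointTrace K , p i)) → ⟦ φ ⟧F (Singleton (pointTrace K)) ρ ⇔ ⟦ φ ⟧ℕ K p
singleton-⇔ K (P a x)  ρ≡ rewrite ρ≡ x = point-marks K _
singleton-⇔ K (x <' y) ρ≡ rewrite ρ≡ x | ρ≡ y = mk⇔ proj₂ ((λ _ _ → refl) ,_)
singleton-⇔ K (x =' y) ρ≡ rewrite ρ≡ x | ρ≡ y = mk⇔ proj₂ ((λ _ _ → refl) ,_)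
singleton-⇔ K (E x y)  ρ≡ rewrite ρ≡ x | ρ≡ y = ⇔.refl
singleton-⇔ K (¬ᶠ φ)   ρ≡ = ¬-cong-⇔ (singleton-⇔ K φ ρ≡)
singleton-⇔ K (φ ∨ᶠ ψ) ρ≡ = singleton-⇔ K φ ρ≡ ⊎-⇔ singleton-⇔ K ψ ρ≡
singleton-⇔ K (∃ᶠ φ) {ρ} {p} ρ≡ = mk⇔
  (λ { (_ , refl , k , h) → k , to (singleton-⇔ K φ (extend-≡ k)) h })
  (λ { (k , h) → pointTrace K , refl , k , from (singleton-⇔ K φ (extend-≡ k)) h })
  where
  extend-≡ : ∀ k i → extend (pointTrace K , k) ρ i ≡ (pointTrace K , extend k p i)
  extend-≡ k Fin.zero    = refl
  extend-≡ k (Fin.suc i) = ρ≡ i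

depth : ∀ {n m} → FO n m → ℕ
depth (¬ᶠ φ)   = depth φ
depth (φ ∨ᶠ ψ) = depth φ ⊔ depth ψ
depth (∃ᶠ φ)   = suc (depth φ)
depth _        = 0

Shifted : ℕ → ℕ → ℕ → Set
Shifted g x y = (x < g × y ≡ x) ⊎ (g ≤ x × y ≡ suc x)

shifted-< : ∀ {g x x' y y'} → Shifted g x x' → Shifted g y y' → (x < y) ⇔ (x' < y')
shifted-< (inj₁ (_ , refl)) (inj₁ (_ , refl)) = ⇔.refl
shifted-< (inj₁ (x<g , refl)) (inj₂ (g≤y , refl)) =
  mk⇔ (λ _ → m≤n⇒m≤1+n (<-≤-trans x<g g≤y)) (λ _ → <-≤-trans x<g g≤y)
shifted-< (inj₂ (g≤x , refl)) (inj₁ (y<g , refl)) =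
  mk⇔ (λ x<y → ⊥-elim (<⇒≱ (<-trans x<y y<g) g≤x))
      (λ 1+x<y → ⊥-elim (<⇒≱ (<-trans (<-trans (n<1+n _) 1+x<y) y<g) g≤x))
shifted-< (inj₂ (_ , refl)) (inj₂ (_ , refl)) = mk⇔ s≤s ≤-pred

shifted-≡ : ∀ {g x x' y y'} → Shifted g x x' → Shifted g y y' → (x ≡ y) ⇔ (x' ≡ y')
shifted-≡ (inj₁ (_ , refl)) (inj₁ (_ , refl)) = ⇔.refl
shifted-≡ (inj₁ (x<g , refl)) (inj₂ (g≤y , refl)) =
  mk⇔ (λ { refl → ⊥-elim (<⇒≱ x<g g≤y) }) (λ { refl → ⊥-elim (<⇒≱ x<g (m≤n⇒m≤1+n g≤y)) })
shifted-≡ (inj₂ (g≤x , refl)) (inj₁ (y<g , refl)) =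
  mk⇔ (λ { refl → ⊥-elim (<⇒≱ y<g g≤x) }) (λ { refl → ⊥-elim (<⇒≱ y<g (m≤n⇒m≤1+n g≤x)) })
shifted-≡ (inj₂ (_ , refl)) (inj₂ (_ , refl)) = mk⇔ (cong suc) suc-injective

Placed : ℕ → ℕ → ℕ → ℕ → Set
Placed d g x y = (x + d ≤ g × y ≡ x) ⊎ (g + d ≤ x × y ≡ suc x)

placed⇒shifted : ∀ {d g x y} → 0 < d → Placed d g x y → Shifted g x y
placed⇒shifted {d} {x = x} 0<d (inj₁ (x+d≤g , y≡x)) = inj₁ (<-≤-trans (m<m+n x 0<d) x+d≤g , y≡x)
placed⇒shifted {d} {g} 0<d (inj₂ (g+d≤x , y≡1+x)) = inj₂ (m+n≤o⇒m≤o g g+d≤x , y≡1+x)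

placed-regap : ∀ {d g g' x y} → g ≤ g' + d → g' ≤ g + d → Placed (d + d) g x y → Placed d g' x y
placed-regap {d} {g} {g'} {x} g≤g'+d _ (inj₁ (x+2d≤g , y≡x)) =
  inj₁ (+-cancelʳ-≤ d (x + d) g' x+d+d≤g'+d , y≡x)
  where
  open ≤-Reasoning
  x+d+d≤g'+d : x + d + d ≤ g' + d
  x+d+d≤g'+d = begin
    x + d + d   ≡⟨ +-assoc x d d ⟩
    x + (d + d) ≤⟨ x+2d≤g ⟩
    g           ≤⟨ g≤g'+d ⟩
    g' + d      ∎
placed-regap {d} {g} {g'} {x} _ g'≤g+d (inj₂ (g+2d≤x , y≡1+x)) = inj₂ (g'+d≤x , y≡1+x)
  where
  open ≤-Reasoning
  g'+d≤x : g' + d ≤ x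
  g'+d≤x = begin
    g' + d      ≤⟨ +-monoˡ-≤ d g'≤g+d ⟩
    g + d + d   ≡⟨ +-assoc g d d ⟩
    g + (d + d) ≤⟨ g+2d≤x ⟩
    x           ∎

-- The Ehrenfeucht–Fraïssé invariant: p and p' agree, except that points beyond the gap move one
-- step right; every point keeps distance d from the gap, and so do 0 and the mark K.
record Similar {m} (d K : ℕ) (p p' : Fin m → ℕ) : Set where
  field
    gap        : ℕ
    room-left  : d ≤ gap
    room-right : gap + d ≤ K
    placed     : ∀ i → Placed d gap (p i) (p' i)

similar-shifted : ∀ {m d K} {p p' : Fin m → ℕ} → 0 < d → (s : Similar d K p p') →
  ∀ i → Shifted (Similar.gap s) (p i) (p' i)
similar-shifted 0<d s i = placed⇒shifted 0<d (Similar.placed s i)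

mark-shifted : ∀ {m d K} {p p' : Fin m → ℕ} (s : Similar d K p p') → Shifted (Similar.gap s) K (suc K)
mark-shifted s = inj₂ (m+n≤o⇒m≤o _ (Similar.room-right s) , refl)

module Extend {m d K} {p p' : Fin m → ℕ} (s : Similar (d + d) K p p') where
  open Similar s

  regap : ∀ g' {z z'} → gap ≤ g' + d → g' ≤ gap + d → d ≤ g' → g' + d ≤ K →
    Placed d g' z z' → Similar d K (extend z p) (extend z' p')
  regap g' near₁ near₂ room₁ room₂ z↦z' = record
    { gap = g' ; room-left = room₁ ; room-right = room₂ ; placed = placed' }
    where
    placed' : ∀ i → Placed d g' (extend _ p i) (extend _ p' i)
    placed' Fin.zero    = z↦z'
    placed' (Fin.suc i) = placed-regap near₁ near₂ (placed i)

  gap+d+d≤K : gap + d + d ≤ K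
  gap+d+d≤K = ≤-trans (≤-reflexive (+-assoc gap d d)) room-right

  d≤gap : d ≤ gap
  d≤gap = m+n≤o⇒m≤o d room-left

  extend-left : ∀ z → z ≤ gap → Similar d K (extend z p) (extend z p')
  extend-left z z≤gap = regap (gap ⊔ (z + d))
    (≤-trans (m≤m⊔n gap (z + d)) (m≤m+n _ d))
    g'≤gap+d
    (≤-trans d≤gap (m≤m⊔n gap (z + d)))
    (≤-trans (+-monoˡ-≤ d g'≤gap+d) gap+d+d≤K)
    (inj₁ (m≤n⊔m gap (z + d) , refl))
    where
    g'≤gap+d : gap ⊔ (z + d) ≤ gap + d
    g'≤gap+d = ⊔-lub (m≤m+n gap d) (+-monoˡ-≤ d z≤gap)

  extend-right : ∀ z → gap ≤ z → Similar d K (extend z p) (extend (suc z) p')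
  extend-right z gap≤z = regap (gap ⊓ (z ∸ d))
    gap≤g'+d
    (≤-trans (m⊓n≤m gap (z ∸ d)) (m≤m+n gap d))
    (⊓-glb d≤gap (m+n≤o⇒m≤o∸n d (≤-trans room-left gap≤z)))
    (≤-trans (+-monoˡ-≤ d (m⊓n≤m gap (z ∸ d))) (≤-trans (m≤m+n _ d) gap+d+d≤K))
    (inj₂ (g'+d≤z , refl))
    where
    z∸d+d≡z : z ∸ d + d ≡ z
    z∸d+d≡z = m∸n+n≡m (≤-trans d≤gap gap≤z)
    gap≤g'+d : gap ≤ gap ⊓ (z ∸ d) + d
    gap≤g'+d = subst (gap ≤_) (sym (+-distribʳ-⊓ d gap (z ∸ d)))
      (⊓-glb (m≤m+n gap d) (subst (gap ≤_) (sym z∸d+d≡z) gap≤z))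
    g'+d≤z : gap ⊓ (z ∸ d) + d ≤ z
    g'+d≤z = subst (gap ⊓ (z ∸ d) + d ≤_) z∸d+d≡z (+-monoˡ-≤ d (m⊓n≤n gap (z ∸ d)))

  forth : ∀ z → Σ ℕ λ z' → Similar d K (extend z p) (extend z' p')
  forth z with z ≤? gap
  ... | yes z≤gap = z , extend-left z z≤gap
  ... | no z≰gap  = suc z , extend-right z (<⇒≤ (≰⇒> z≰gap))

  back : ∀ z' → Σ ℕ λ z → Similar d K (extend z p) (extend z' p')
  back z' with z' ≤? gap
  back z'      | yes z'≤gap = z' , extend-left z' z'≤gap
  back zero    | no 0≰gap   = ⊥-elim (0≰gap z≤n)
  back (suc z) | no z'≰gap  = z , extend-right z (≤-pred (≰⇒> z'≰gap))

similar-⇔ : ∀ {n m} (φ : FO n m) r {K} {p p' : Fin m → ℕ} → depth φ ≤ r →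
  Similar (2 ^ r) K p p' → ⟦ φ ⟧ℕ K p ⇔ ⟦ φ ⟧ℕ (suc K) p'
similar-⇔ (P a x)  r _ s = shifted-≡ (similar-shifted (m^n>0 2 r) s x) (mark-shifted s)
similar-⇔ (x <' y) r _ s = shifted-< (similar-shifted (m^n>0 2 r) s x) (similar-shifted (m^n>0 2 r) s y)
similar-⇔ (x =' y) r _ s = shifted-≡ (similar-shifted (m^n>0 2 r) s x) (similar-shifted (m^n>0 2 r) s y)
similar-⇔ (E x y)  r _ s = shifted-≡ (similar-shifted (m^n>0 2 r) s x) (similar-shifted (m^n>0 2 r) s y)
similar-⇔ (¬ᶠ φ) r d≤r s = ¬-cong-⇔ (similar-⇔ φ r d≤r s)
similar-⇔ (φ ∨ᶠ ψ) r d≤r s =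
  similar-⇔ φ r (m⊔n≤o⇒m≤o (depth φ) _ d≤r) s ⊎-⇔
  similar-⇔ ψ r (m⊔n≤o⇒n≤o (depth φ) _ d≤r) s
similar-⇔ (∃ᶠ φ) (suc r) {K} {p} {p'} (s≤s d≤r) s = mk⇔
  (λ (z , h) → let (z' , s') = forth z in z' , to (similar-⇔ φ r d≤r s') h)
  (λ (z' , h) → let (z , s') = back z' in z , from (similar-⇔ φ r d≤r s') h)
  where open Extend {d = 2 ^ r} (subst (λ d → Similar d K p p') (cong (2 ^ r +_) (+-identityʳ (2 ^ r))) s)

singletons-FO-indistinguishable : ∀ {n} (ψ : FOSentence n) → let K = 2 ^ depth ψ + 2 ^ depth ψ in
  Singleton (pointTrace K) ⊨F ψ → Singleton (pointTrace (suc K)) ⊨F ψ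
singletons-FO-indistinguishable ψ =
  from (singleton-⇔ (suc K) ψ (λ ())) ∘
  to (similar-⇔ ψ (depth ψ) ≤-refl initial) ∘
  to (singleton-⇔ K ψ (λ ()))
  where
  d K : ℕ
  d = 2 ^ depth ψ
  K = d + d
  initial : Similar d K emptyEnv emptyEnv
  initial = record { gap = d ; room-left = ≤-refl ; room-right = ≤-refl ; placed = λ () }

isEven : ℕ → Bool
isEven zero    = true
isEven (suc k) = not (isEven k)

isEven-double : ∀ m → isEven (m + m) ≡ true
isEven-double zero    = refl
isEven-double (suc m) rewrite +-suc m m | not-involutive (isEven (m + m)) = isEven-double m

alternating-isEven : ∀ {s : PTrace} {j} → s 0 ≡ true → (∀ k → k < j → s (suc k) ≡ not (s k)) →
  ∀ k → k ≤ j → s k ≡ isEven k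
alternating-isEven s0 alt zero    _     = s0
alternating-isEven s0 alt (suc k) 1+k≤j =
  trans (alt k 1+k≤j) (cong not (alternating-isEven s0 alt k (≤-trans (n≤1+n k) 1+k≤j)))

module _ {n : ℕ} where
  private
    q : Body (suc n) 1 1
    q = pvar Fin.zero

  alternates : Body (suc n) 1 1
  alternates = ¬' (q ↔' (X' q))

  alternates-⇔ : ∀ Πt (Πq : Fin 0 → PTrace) s j →
    ⟦ alternates ⟧B Πt (extend s Πq) j ⇔ (s (suc j) ≡ not (s j))
  alternates-⇔ Πt Πq s j = ⇔.trans (¬-cong-⇔ (↔'-bool (s j) (s (suc j))))
    (mk⇔ (λ s≢ → ¬-not (s≢ ∘ sym)) (λ s'≡ s≡ → not-¬ refl (trans s≡ s'≡)))

  evenMark : HyperQPTL (suc n)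
  evenMark = ∀π (∃q (body (q ∧' (alternates U' (q ∧' atom Fin.zero Fin.zero)))))

  evenMark-even : ∀ K → isEven K ≡ true → Singleton (pointTrace K) ⊨H evenMark
  evenMark-even K K-even _ refl = isEven , ∧'-intro refl
    (K , z≤n , ∧'-intro K-even (from (point-marks K K) refl) ,
     λ k _ _ → from (alternates-⇔ (extend (pointTrace K) emptyEnv) emptyEnv isEven k) refl)

  evenMark-odd : ∀ K → isEven K ≡ true → ¬ (Singleton (pointTrace (suc K)) ⊨H evenMark)
  evenMark-odd K K-even sat with sat (pointTrace (suc K)) refl
  ... | s , q∧U with s 0 ≟ᵇ true
  ...   | no s0≢true = q∧U (inj₁ s0≢true)
  ...   | yes s0 = q∧U (inj₂ λ (j , _ , q∧a , alt) → no-even-mark j q∧a alt)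
    where
    Πt : Fin 1 → Trace (suc n)
    Πt = extend (pointTrace (suc K)) emptyEnv
    no-even-mark : ∀ j → ⟦ q ∧' atom Fin.zero Fin.zero ⟧B Πt (extend s emptyEnv) j →
      (∀ k → 0 ≤ k → k < j → ⟦ alternates ⟧B Πt (extend s emptyEnv) k) → ⊥
    no-even-mark j q∧a alt = not-¬ refl (begin
      isEven K         ≡⟨ K-even ⟩
      true             ≡⟨ sym (proj₁ q∧a-holds) ⟩
      s j              ≡⟨ alternating-isEven s0 s-alternates j ≤-refl ⟩
      isEven j         ≡⟨ cong isEven (to (point-marks (suc K) j) (proj₂ q∧a-holds)) ⟩
      not (isEven K)   ∎)
      where
      open ≡-Reasoning
      q∧a-holds : s j ≡ true × point (suc K) j ≡ true
      q∧a-holds = ∧'-elim (decidable-stable (s j ≟ᵇ true)) (decidable-stable (point (suc K) j ≟ᵇ true)) q∧a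
      s-alternates : ∀ k → k < j → s (suc k) ≡ not (s k)
      s-alternates k k<j = to (alternates-⇔ Πt emptyEnv s k) (alt k z≤n k<j)

evenMark-not-FO-definable : ∀ {n} (ψ : FOSentence (suc n)) → ¬ Equivalent ψ evenMark
evenMark-not-FO-definable ψ ψ≡φ = evenMark-odd K K-even
  (proj₁ (ψ≡φ _) (singletons-FO-indistinguishable ψ (proj₂ (ψ≡φ _) (evenMark-even K K-even))))
  where
  K : ℕ
  K = 2 ^ depth ψ + 2 ^ depth ψ
  K-even : isEven K ≡ true
  K-even = isEven-double (2 ^ depth ψ)

theorem1 : ExcludedMiddle 0ℓ →
    (n : ℕ) →
      ((ψ : FOSentence n) → Σ (HyperQPTL n) λ φ → Equivalent ψ φ)
      × (0 < n → Σ (HyperQPTL n) λ φ → (ψ : FOSentence n) → ¬ Equivalent ψ φ)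
theorem1 em zero    = Classical.FO⇒HyperQPTL em , λ ()
theorem1 em (suc n) = Classical.FO⇒HyperQPTL em , λ _ → evenMark , evenMark-not-FO-definable
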